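{- For all integers $k\ge2$ and $n\ge2$, $\mathsf{ACC}_k\le_{\mathrm W}(\mathsf{PHP}^{n^{k+1}}_n)'$.
   Context: A number $N\ge1$ is identified with $\{0,\dots,N-1\}$. Problems have instances and solutions coded as elements of Baire space $\mathbb N^{\mathbb N}$. $\mathsf{P}\le_{\mathrm W}\mathsf{Q}$ (Weihrauch reducibility) if there are Turing functionals (effectively continuous partial maps on $\mathbb N^{\mathbb N}$) $\Phi,\Psi$ such that for every $\mathsf{P}$-instance $p$, $\Phi(p)$ is a $\mathsf{Q}$-instance and for every $\mathsf{Q}$-solution $q$ of $\Phi(p)$, $\Psi(p,q)$ is a $\mathsf{P}$-solution of $p$. For $m>n\ge2$, $(\mathsf{PHP}^m_n)'$ has as instances all pointwise convergent sequences $(f_s:m\to n)_{s\in\mathbb N}$, with solutions all unordered pairs $\{i,j\}$, $i\ne j$, with $\lim_s f_s(i)=\lim_s f_s(j)$. For $k\ge2$, $\mathsf{ACC}_k$ has as instances those $p\in\mathbb N^{\mathbb N}$ such that either there is a unique $\ell<k$ that appears in $p$ (then every $j<k$, $j\ne\ell$, is a solution), or $p$ is the constant sequence with value $k$ (then every $j<k$ is a solution). -}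

module Defs where

open import Data.Nat using (ℕ; zero; suc; _+_; _*_; _^_; _≤_; _<_)
open import Data.Fin using (Fin)
open import Data.Vec using (Vec; []; _∷_; lookup)
open import Data.Maybe using (Maybe; just; nothing; _>>=_)
open import Data.Product using (Σ; ∃; _×_)
open import Data.Sum using (_⊎_)
open import Relation.Binary.PropositionalEquality using (_≡_; _≢_)

Baire : Set
Baire = ℕ → ℕ

-- Oracle partial recursive functions (a model of Turing functionals)
-- PR k : codes of k-ary partial recursive functions relative to an
-- oracle in Baire space.

data PR : ℕ → Set where
  zeroF : ∀ {k} → PR k
  succF : PR 1
  proj  : ∀ {k} → Fin k → PR k
  orc   : PR 1
  comp  : ∀ {k m} → PR m → Vec (PR k) m → PR k
  prec  : ∀ {k} → PR k → PR (suc (suc k)) → PR (suc k)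
  mu    : ∀ {k} → PR (suc k) → PR k

mutual
  eval : ℕ → Baire → ∀ {k} → PR k → Vec ℕ k → Maybe ℕ
  eval zero    p c            xs            = nothing
  eval (suc f) p zeroF        xs            = just 0
  eval (suc f) p succF        (x ∷ [])      = just (suc x)
  eval (suc f) p (proj i)     xs            = just (lookup xs i)
  eval (suc f) p orc          (x ∷ [])      = just (p x)
  eval (suc f) p (comp g hs)  xs            = evalV f p hs xs >>= λ ys → eval f p g ys
  eval (suc f) p (prec g h)   (zero ∷ xs)   = eval f p g xs
  eval (suc f) p (prec g h)   (suc x ∷ xs)  =
    eval f p (prec g h) (x ∷ xs) >>= λ r → eval f p h (x ∷ r ∷ xs)
  eval (suc f) p (mu g)       xs            = search f p g xs 0

  evalV : ℕ → Baire → ∀ {k m} → Vec (PR k) m → Vec ℕ k → Maybe (Vec ℕ m)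
  evalV f p []       xs = just []
  evalV f p (h ∷ hs) xs =
    eval f p h xs >>= λ y → evalV f p hs xs >>= λ ys → just (y ∷ ys)

  search : ℕ → Baire → ∀ {k} → PR (suc k) → Vec ℕ k → ℕ → Maybe ℕ
  search zero    p g xs i = nothing
  search (suc f) p g xs i = eval f p g (i ∷ xs) >>= step
    where
    step : ℕ → Maybe ℕ
    step zero    = just i
    step (suc _) = search f p g xs (suc i)

_⟨_⟩_↓_ : PR 1 → Baire → ℕ → ℕ → Set
Φ ⟨ p ⟩ x ↓ v = ∃ λ f → eval f p Φ (x ∷ []) ≡ just v

Computes : PR 1 → Baire → Baire → Set
Computes Φ p q = ∀ x → Φ ⟨ p ⟩ x ↓ q x

-- Join ⟨p,q⟩ of two elements of Baire space: p on even, q on odd positions.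
join : Baire → Baire → Baire
join p q zero          = p 0
join p q (suc zero)    = q 0
join p q (suc (suc n)) = join (λ i → p (suc i)) (λ i → q (suc i)) n

record Problem : Set₁ where
  field
    Inst : Baire → Set
    Sol  : Baire → Baire → Set

open Problem public

_≤W_ : Problem → Problem → Set
P ≤W Q = Σ (PR 1) λ Φ → Σ (PR 1) λ Ψ →
  ∀ p → Inst P p →
    ∃ λ x → Computes Φ p x × Inst Q x ×
      (∀ y → Sol Q x y →
        ∃ λ z → Computes Ψ (join p y) z × Sol P p z)

-- ACC_k.  A solution j < k is coded by any q with q 0 = j.

Appears : ℕ → Baire → Set
Appears ℓ p = ∃ λ i → p i ≡ ℓ

UniqueBelow : ℕ → ℕ → Baire → Set
UniqueBelow k ℓ p = ℓ < k × Appears ℓ p × (∀ j → j < k → Appears j p → j ≡ ℓ)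

ACC : ℕ → Problem
Inst (ACC k) p =
  (∃ λ ℓ → UniqueBelow k ℓ p)
  ⊎ (∀ i → p i ≡ k)
Sol (ACC k) p q =
  q 0 < k × (∀ ℓ → UniqueBelow k ℓ p → q 0 ≢ ℓ)

-- (PHP^m_n)'.  A sequence (f_s : m → n)_s is coded by p with
-- f_s(i) = p (s * m + i) for i < m.  An unordered pair {i,j} is coded
-- by any q with {q 0, q 1} = {i,j}.

Lim : ℕ → Baire → ℕ → ℕ → Set
Lim m p i v = ∃ λ s₀ → ∀ s → s₀ ≤ s → p (s * m + i) ≡ v

PHP′ : ℕ → ℕ → Problem
Inst (PHP′ m n) p =
  (∀ s i → i < m → p (s * m + i) < n) ×
  (∀ i → i < m → ∃ λ v → Lim m p i v)
Sol (PHP′ m n) p q =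
  q 0 < m × q 1 < m × q 0 ≢ q 1 ×
  (∃ λ v → Lim m p (q 0) v × Lim m p (q 1) v)

module Submission where

-- Stage s of the PHP′ instance colours pigeon i < n ^ (k + 1) by its c-th base-n digit, where c is
-- the running minimum of k, p 0, p 1, … up to position s · n ^ (k + 1) + i.  This minimum settles
-- on the unique value ℓ < k occurring in p, or on k when p is constantly k, so each colour converges
-- to the digit at the limit c.  Two distinct pigeons of equal limit colour agree in digit c but
-- differ in some digit d ≤ k.  Hence Ψ searches at once for a digit d < k where they differ, which
-- answers ACC since d ≠ c, and for a t with p t < k, which reveals ℓ = p t, so that any other
-- number below 2 ≤ k answers.  The search succeeds: if the pigeons differ only in digit k, then
-- c ≠ k, so p is not constantly k and ℓ occurs in p.

open import Defs
open import Data.Nat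
  using (ℕ; zero; suc; pred; _+_; _*_; _∸_; _^_; _⊓_; _⊔_; _≤_; _<_; z≤n; s≤s; z<s; _≟_; _<?_;
         NonZero; >-nonZero; >-nonZero⁻¹)
open import Data.Nat.Properties
open import Data.Nat.DivMod
  using (_%_; _/_; m≡m%n+[m/n]*n; m%n<n; m<n⇒m%n≡m; [m+kn]%n≡m%n; %-congˡ; 0/n≡0; m<n*o⇒m/o<n)
open import Data.Fin using (Fin; #_)
open import Data.Vec using (Vec; []; _∷_; [_]; lookup)
open import Data.Vec.Relation.Binary.Pointwise.Inductive using (Pointwise; []; _∷_)
open import Data.Maybe using (Maybe; just; _>>=_)
open import Data.Product using (∃; _×_; _,_; proj₁; proj₂)
open import Data.Sum using (_⊎_; inj₁; inj₂)
open import Relation.Binary.Definitions using (tri<; tri≈; tri>)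
open import Relation.Binary.PropositionalEquality
  using (_≡_; _≢_; refl; sym; trans; cong; cong₂; subst; module ≡-Reasoning)
open import Relation.Nullary using (yes; no; contradiction)

>>=-just : ∀ {A B : Set} {m : Maybe A} {g : A → Maybe B} {a b} →
           m ≡ just a → g a ≡ just b → (m >>= g) ≡ just b
>>=-just refl e = e

>>=-just⁻¹ : ∀ {A B : Set} (m : Maybe A) {g : A → Maybe B} {b} →
             (m >>= g) ≡ just b → ∃ λ a → m ≡ just a × g a ≡ just b
>>=-just⁻¹ (just a) e = a , refl , e

private variable
  k : ℕ
  xs : Vec ℕ k
  a b c : PR k
  u v w : ℕ

infix 4 _⟨_⟩_⇓_ _⟨_⟩_⇓*_

_⟨_⟩_⇓_ : ∀ {k} → PR k → Baire → Vec ℕ k → ℕ → Set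
c ⟨ p ⟩ xs ⇓ v = ∃ λ f → eval f p c xs ≡ just v

_⟨_⟩_⇓*_ : ∀ {k m} → Vec (PR k) m → Baire → Vec ℕ k → Vec ℕ m → Set
hs ⟨ p ⟩ xs ⇓* vs = Pointwise (λ h v → h ⟨ p ⟩ xs ⇓ v) hs vs

module _ {p : Baire} where

  mutual
    eval-mono : ∀ {f f' k} (c : PR k) {xs v} →
                f ≤ f' → eval f p c xs ≡ just v → eval f' p c xs ≡ just v
    eval-mono {zero} c _ ()
    eval-mono {suc f} zeroF (s≤s _) e = e
    eval-mono {suc f} succF {_ ∷ []} (s≤s _) e = e
    eval-mono {suc f} (proj i) (s≤s _) e = e
    eval-mono {suc f} orc {_ ∷ []} (s≤s _) e = e
    eval-mono {suc f} (comp g hs) {xs} (s≤s le) e with >>=-just⁻¹ (evalV f p hs xs) e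
    ... | ys , e-hs , e-g = >>=-just (evalV-mono hs le e-hs) (eval-mono g le e-g)
    eval-mono {suc f} (prec g h) {zero ∷ _} (s≤s le) e = eval-mono g le e
    eval-mono {suc f} (prec g h) {suc x ∷ xs} (s≤s le) e
      with >>=-just⁻¹ (eval f p (prec g h) (x ∷ xs)) e
    ... | r , e-rec , e-h = >>=-just (eval-mono (prec g h) le e-rec) (eval-mono h le e-h)
    eval-mono {suc f} (mu g) (s≤s le) e = search-mono g le e

    evalV-mono : ∀ {f f' k m} (hs : Vec (PR k) m) {xs vs} →
                 f ≤ f' → evalV f p hs xs ≡ just vs → evalV f' p hs xs ≡ just vs
    evalV-mono [] _ e = e
    evalV-mono {f} (h ∷ hs) {xs} le e with >>=-just⁻¹ (eval f p h xs) e
    ... | y , e-h , e' with >>=-just⁻¹ (evalV f p hs xs) e'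
    ...   | ys , e-hs , e'' = >>=-just (eval-mono h le e-h) (>>=-just (evalV-mono hs le e-hs) e'')

    search-mono : ∀ {f f' k} (g : PR (suc k)) {xs i v} →
                  f ≤ f' → search f p g xs i ≡ just v → search f' p g xs i ≡ just v
    search-mono {zero} g _ ()
    search-mono {suc f} g {xs} {i} (s≤s le) e with >>=-just⁻¹ (eval f p g (i ∷ xs)) e
    ... | zero  , e-g , e' = >>=-just (eval-mono g le e-g) e'
    ... | suc _ , e-g , e' = >>=-just (eval-mono g le e-g) (search-mono g le e')

  ⇓-≡ : u ≡ w → c ⟨ p ⟩ xs ⇓ u → c ⟨ p ⟩ xs ⇓ w
  ⇓-≡ refl c⇓ = c⇓

  zero-⇓ : zeroF ⟨ p ⟩ xs ⇓ 0
  zero-⇓ = 1 , refl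

  succ-⇓ : ∀ {x} → succF ⟨ p ⟩ [ x ] ⇓ suc x
  succ-⇓ = 1 , refl

  proj-⇓ : ∀ {i : Fin k} → proj i ⟨ p ⟩ xs ⇓ lookup xs i
  proj-⇓ = 1 , refl

  orc-⇓ : ∀ {x} → orc ⟨ p ⟩ [ x ] ⇓ p x
  orc-⇓ = 1 , refl

  evalV-⇓ : ∀ {k m} {hs : Vec (PR k) m} {xs ys} →
            hs ⟨ p ⟩ xs ⇓* ys → ∃ λ f → evalV f p hs xs ≡ just ys
  evalV-⇓ [] = 0 , refl
  evalV-⇓ {hs = h ∷ hs} ((f , e) ∷ hs⇓) with evalV-⇓ hs⇓
  ... | f' , e' = f ⊔ f' ,
    >>=-just (eval-mono h (m≤m⊔n f f') e) (>>=-just (evalV-mono hs (m≤n⊔m f f') e') refl)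

  comp-⇓ : ∀ {k m} {g : PR m} {hs : Vec (PR k) m} {xs ys v} →
           hs ⟨ p ⟩ xs ⇓* ys → g ⟨ p ⟩ ys ⇓ v → comp g hs ⟨ p ⟩ xs ⇓ v
  comp-⇓ {g = g} {hs} hs⇓ (f' , e') with evalV-⇓ hs⇓
  ... | f , e = suc (f ⊔ f') , >>=-just (evalV-mono hs (m≤m⊔n f f') e) (eval-mono g (m≤n⊔m f f') e')

  prec-⇓ : ∀ {k} {g : PR k} {h : PR (suc (suc k))} {xs} (S : ℕ → ℕ) → g ⟨ p ⟩ xs ⇓ S 0
         → (∀ x → h ⟨ p ⟩ (x ∷ S x ∷ xs) ⇓ S (suc x)) → ∀ x → prec g h ⟨ p ⟩ (x ∷ xs) ⇓ S x
  prec-⇓ S (f , e) h⇓ zero = suc f , e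
  prec-⇓ {g = g} {h} S g⇓ h⇓ (suc x) with prec-⇓ S g⇓ h⇓ x | h⇓ x
  ... | f , e | f' , e' = suc (f ⊔ f') ,
    >>=-just (eval-mono (prec g h) (m≤m⊔n f f') e) (eval-mono h (m≤n⊔m f f') e')

  search-⇓ : ∀ {k} {g : PR (suc k)} {xs} (H : ℕ → ℕ) → (∀ i → g ⟨ p ⟩ (i ∷ xs) ⇓ H i)
           → ∀ d i → H (d + i) ≡ 0 → ∃ λ r → H r ≡ 0 × ∃ λ f → search f p g xs i ≡ just r
  search-⇓ {g = g} H g⇓ d i H[d+i]≡0 with g⇓ i | H i in Hi
  ... | f , e | zero = i , Hi , suc f , >>=-just (trans e (cong just Hi)) refl
  ... | f , e | suc _ with d
  ...   | zero = contradiction (trans (sym Hi) H[d+i]≡0) λ ()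
  ...   | suc d with search-⇓ H g⇓ d (suc i) (trans (cong H (+-suc d i)) H[d+i]≡0)
  ...     | r , Hr≡0 , f' , e' = r , Hr≡0 , suc (f ⊔ f') ,
    >>=-just (eval-mono g (m≤m⊔n f f') (trans e (cong just Hi))) (search-mono g (m≤n⊔m f f') e')

  mu-⇓ : ∀ {k} {g : PR (suc k)} {xs} (H : ℕ → ℕ) → (∀ i → g ⟨ p ⟩ (i ∷ xs) ⇓ H i)
       → ∀ {j} → H j ≡ 0 → ∃ λ r → H r ≡ 0 × mu g ⟨ p ⟩ xs ⇓ r
  mu-⇓ H g⇓ {j} Hj≡0 with search-⇓ H g⇓ j 0 (trans (cong H (+-identityʳ j)) Hj≡0)
  ... | r , Hr≡0 , f , e = r , Hr≡0 , suc f , e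

infix 5 ifZero_then_else_

ifZero_then_else_ : ℕ → ℕ → ℕ → ℕ
ifZero zero  then a else b = a
ifZero suc _ then a else b = b

ifZero-∸-≤ : ∀ {m n a b} → m ≤ n → ifZero (m ∸ n) then a else b ≡ a
ifZero-∸-≤ {a = a} {b} m≤n = cong (ifZero_then a else b) (m≤n⇒m∸n≡0 m≤n)

ifZero-∸-> : ∀ {m n a b} → n < m → ifZero (m ∸ n) then a else b ≡ b
ifZero-∸-> {suc m} {zero} _ = refl
ifZero-∸-> {suc m} {suc n} (s≤s n<m) = ifZero-∸-> n<m

isZero : ℕ → ℕ
isZero a = ifZero a then 1 else 0

isZero-< : ∀ a → isZero a < 2
isZero-< zero = s≤s (s≤s z≤n)
isZero-< (suc _) = s≤s z≤n

isZero-≢ : ∀ a → isZero a ≢ a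
isZero-≢ zero ()
isZero-≢ (suc _) ()

-- Characteristic functions in the convention of the μ-operator: the value 0 means true.
χ< : ℕ → ℕ → ℕ
χ< a b = isZero (b ∸ a)

χ≢ : ℕ → ℕ → ℕ
χ≢ a b = ifZero (a ∸ b) then χ< a b else 0

<⇒χ<≡0 : ∀ {a b} → a < b → χ< a b ≡ 0
<⇒χ<≡0 = ifZero-∸->

χ<≡0⇒< : ∀ {a b} → χ< a b ≡ 0 → a < b
χ<≡0⇒< {a} {b} χ≡0 with a <? b
... | yes a<b = a<b
... | no a≮b = contradiction (trans (sym (ifZero-∸-≤ (≮⇒≥ a≮b))) χ≡0) λ ()

≢⇒χ≢≡0 : ∀ {a b} → a ≢ b → χ≢ a b ≡ 0
≢⇒χ≢≡0 {a} {b} a≢b with <-cmp a b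
... | tri< a<b _ _ = trans (ifZero-∸-≤ (<⇒≤ a<b)) (<⇒χ<≡0 a<b)
... | tri≈ _ a≡b _ = contradiction a≡b a≢b
... | tri> _ _ b<a = ifZero-∸-> b<a

χ≢≡0⇒≢ : ∀ {a b} → χ≢ a b ≡ 0 → a ≢ b
χ≢≡0⇒≢ {a} χ≡0 refl = n≮n a (χ<≡0⇒< (trans (sym (ifZero-∸-≤ {a} {a} ≤-refl)) χ≡0))

m∸[m∸n]≡m⊓n : ∀ m n → m ∸ (m ∸ n) ≡ m ⊓ n
m∸[m∸n]≡m⊓n m n with ≤-total m n
... | inj₁ m≤n = trans (cong (m ∸_) (m≤n⇒m∸n≡0 m≤n)) (sym (m≤n⇒m⊓n≡m m≤n))
... | inj₂ n≤m = trans (m∸[m∸n]≡n n≤m) (sym (m≥n⇒m⊓n≡n n≤m))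

module _ (N : ℕ) .{{_ : NonZero N}} where
  open ≡-Reasoning

  %-/-unique : ∀ {x r q} → r < N → x ≡ r + q * N → x % N ≡ r × x / N ≡ q
  %-/-unique {x} {r} {q} r<N x≡r+qN = x%N≡r , *-cancelʳ-≡ (x / N) q N (+-cancelˡ-≡ r _ _ (begin
      r + x / N * N      ≡⟨ cong (_+ x / N * N) x%N≡r ⟨
      x % N + x / N * N  ≡⟨ m≡m%n+[m/n]*n x N ⟨
      x                  ≡⟨ x≡r+qN ⟩
      r + q * N          ∎))
    where
    x%N≡r : x % N ≡ r
    x%N≡r = begin
      x % N            ≡⟨ %-congˡ x≡r+qN ⟩
      (r + q * N) % N  ≡⟨ [m+kn]%n≡m%n r q N ⟩
      r % N            ≡⟨ m<n⇒m%n≡m r<N ⟩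
      r                ∎

  %-/-injective : ∀ {x y} → x % N ≡ y % N → x / N ≡ y / N → x ≡ y
  %-/-injective {x} {y} %≡ /≡ = begin
    x                  ≡⟨ m≡m%n+[m/n]*n x N ⟩
    x % N + x / N * N  ≡⟨ cong₂ (λ r q → r + q * N) %≡ /≡ ⟩
    y % N + y / N * N  ≡⟨ m≡m%n+[m/n]*n y N ⟨
    y                  ∎

  suc-%-/ : ∀ x → suc x % N ≡ ifZero (N ∸ suc (x % N)) then 0 else suc (x % N)
                × suc x / N ≡ ifZero (N ∸ suc (x % N)) then suc (x / N) else x / N
  suc-%-/ x with <-cmp (suc (x % N)) N
  ... | tri< no-carry _ _ =
    let %≡ , /≡ = %-/-unique {q = x / N} no-carry (cong suc (m≡m%n+[m/n]*n x N))
    in trans %≡ (sym (ifZero-∸-> no-carry)) , trans /≡ (sym (ifZero-∸-> no-carry))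
  ... | tri≈ _ carry _ =
    let %≡ , /≡ = %-/-unique {q = suc (x / N)} (>-nonZero⁻¹ N)
                    (trans (cong suc (m≡m%n+[m/n]*n x N)) (cong (_+ x / N * N) carry))
        N≤1+x%N = ≤-reflexive (sym carry)
    in trans %≡ (sym (ifZero-∸-≤ N≤1+x%N)) , trans /≡ (sym (ifZero-∸-≤ N≤1+x%N))
  ... | tri> _ _ N<suc = contradiction (m%n<n x N) (<⇒≱ N<suc)

  dropDigits : ℕ → ℕ → ℕ
  dropDigits x zero    = x
  dropDigits x (suc d) = dropDigits x d / N

  dropDigits-suc : ∀ x d → dropDigits x (suc d) ≡ dropDigits (x / N) d
  dropDigits-suc x zero    = refl
  dropDigits-suc x (suc d) = cong (_/ N) (dropDigits-suc x d)

  digit : ℕ → ℕ → ℕ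
  digit x d = dropDigits x d % N

  digit-suc : ∀ x d → digit x (suc d) ≡ digit (x / N) d
  digit-suc x d = cong (_% N) (dropDigits-suc x d)

  m<N^[1+K]⇒m/N<N^K : ∀ {m} K → m < N ^ suc K → m / N < N ^ K
  m<N^[1+K]⇒m/N<N^K {m} K m< = m<n*o⇒m/o<n (subst (m <_) (*-comm N (N ^ K)) m<)

  digits-separate : ∀ K {i j} → i < N ^ K → j < N ^ K → i ≢ j →
                    ∃ λ d → d < K × digit i d ≢ digit j d
  digits-separate zero (s≤s z≤n) (s≤s z≤n) i≢j = contradiction refl i≢j
  digits-separate (suc K) {i} {j} i< j< i≢j with i % N ≟ j % N
  ... | no i%≢j% = 0 , z<s , i%≢j%
  ... | yes i%≡j% with digits-separate K (m<N^[1+K]⇒m/N<N^K K i<) (m<N^[1+K]⇒m/N<N^K K j<)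
                         (λ /≡ → i≢j (%-/-injective i%≡j% /≡))
  ...   | d , d<K , differ =
    suc d , s≤s d<K , λ eq → differ (trans (sym (digit-suc i d)) (trans eq (digit-suc j d)))

infixl 7 _%ᴾ_ _/ᴾ_ _⊓ᴾ_
infixl 6 _+ᴾ_ _∸ᴾ_
infix 5 ifZeroᴾ_then_else_

succᴾ : ∀ {k} → PR k → PR k
succᴾ a = comp succF [ a ]

oracleᴾ : ∀ {k} → PR k → PR k
oracleᴾ a = comp orc [ a ]

constᴾ : ∀ {k} → ℕ → PR k
constᴾ zero    = zeroF
constᴾ (suc c) = succᴾ (constᴾ c)

predF : PR 1
predF = prec zeroF (proj (# 0))

subF : PR 2
subF = prec (proj (# 0)) (comp predF [ proj (# 1) ])

_∸ᴾ_ : ∀ {k} → PR k → PR k → PR k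
a ∸ᴾ b = comp subF (b ∷ a ∷ [])

addF : PR 2
addF = prec (proj (# 0)) (succᴾ (proj (# 1)))

_+ᴾ_ : ∀ {k} → PR k → PR k → PR k
a +ᴾ b = comp addF (a ∷ b ∷ [])

ifZeroF : PR 3
ifZeroF = prec (proj (# 0)) (proj (# 3))

ifZeroᴾ_then_else_ : ∀ {k} → PR k → PR k → PR k → PR k
ifZeroᴾ c then a else b = comp ifZeroF (c ∷ a ∷ b ∷ [])

_⊓ᴾ_ : ∀ {k} → PR k → PR k → PR k
a ⊓ᴾ b = a ∸ᴾ (a ∸ᴾ b)

isZeroᴾ : ∀ {k} → PR k → PR k
isZeroᴾ a = ifZeroᴾ a then constᴾ 1 else constᴾ 0

χ<ᴾ : ∀ {k} → PR k → PR k → PR k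
χ<ᴾ a b = isZeroᴾ (b ∸ᴾ a)

χ≢ᴾ : ∀ {k} → PR k → PR k → PR k
χ≢ᴾ a b = ifZeroᴾ a ∸ᴾ b then χ<ᴾ a b else constᴾ 0

modF : ℕ → PR 1
modF N = prec zeroF (ifZeroᴾ constᴾ N ∸ᴾ succᴾ (proj (# 1)) then constᴾ 0 else succᴾ (proj (# 1)))

_%ᴾ_ : ∀ {k} → PR k → ℕ → PR k
a %ᴾ N = comp (modF N) [ a ]

divF : ℕ → PR 1
divF N = prec zeroF
  (ifZeroᴾ constᴾ N ∸ᴾ succᴾ (proj (# 0) %ᴾ N) then succᴾ (proj (# 1)) else proj (# 1))

_/ᴾ_ : ∀ {k} → PR k → ℕ → PR k
a /ᴾ N = comp (divF N) [ a ]

dropDigitsF : ℕ → PR 2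
dropDigitsF N = prec (proj (# 0)) (proj (# 1) /ᴾ N)

digitᴾ : ∀ {k} → ℕ → PR k → PR k → PR k
digitᴾ N a d = comp (dropDigitsF N) (d ∷ a ∷ []) %ᴾ N

module _ {p : Baire} where

  succᴾ-⇓ : a ⟨ p ⟩ xs ⇓ u → succᴾ a ⟨ p ⟩ xs ⇓ suc u
  succᴾ-⇓ a⇓ = comp-⇓ (a⇓ ∷ []) succ-⇓

  oracleᴾ-⇓ : a ⟨ p ⟩ xs ⇓ u → oracleᴾ a ⟨ p ⟩ xs ⇓ p u
  oracleᴾ-⇓ a⇓ = comp-⇓ (a⇓ ∷ []) orc-⇓

  constᴾ-⇓ : ∀ c → constᴾ c ⟨ p ⟩ xs ⇓ c
  constᴾ-⇓ zero    = zero-⇓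
  constᴾ-⇓ (suc c) = succᴾ-⇓ (constᴾ-⇓ c)

  ∸ᴾ-⇓ : a ⟨ p ⟩ xs ⇓ u → b ⟨ p ⟩ xs ⇓ w → a ∸ᴾ b ⟨ p ⟩ xs ⇓ u ∸ w
  ∸ᴾ-⇓ {u = u} a⇓ b⇓ = comp-⇓ (b⇓ ∷ a⇓ ∷ []) (prec-⇓ (u ∸_) proj-⇓ sub-step _)
    where
    pred-⇓ : ∀ x → predF ⟨ p ⟩ [ x ] ⇓ pred x
    pred-⇓ = prec-⇓ pred zero-⇓ λ _ → proj-⇓
    sub-step : ∀ x → comp predF [ proj (# 1) ] ⟨ p ⟩ (x ∷ u ∸ x ∷ [ u ]) ⇓ u ∸ suc x
    sub-step x = ⇓-≡ (pred[m∸n]≡m∸[1+n] u x) (comp-⇓ (proj-⇓ ∷ []) (pred-⇓ (u ∸ x)))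

  +ᴾ-⇓ : a ⟨ p ⟩ xs ⇓ u → b ⟨ p ⟩ xs ⇓ w → a +ᴾ b ⟨ p ⟩ xs ⇓ u + w
  +ᴾ-⇓ {w = w} a⇓ b⇓ = comp-⇓ (a⇓ ∷ b⇓ ∷ []) (prec-⇓ (_+ w) proj-⇓ (λ _ → succᴾ-⇓ proj-⇓) _)

  ifZeroᴾ-⇓ : c ⟨ p ⟩ xs ⇓ v → a ⟨ p ⟩ xs ⇓ u → b ⟨ p ⟩ xs ⇓ w
            → ifZeroᴾ c then a else b ⟨ p ⟩ xs ⇓ ifZero v then u else w
  ifZeroᴾ-⇓ {u = u} {w = w} c⇓ a⇓ b⇓ =
    comp-⇓ (c⇓ ∷ a⇓ ∷ b⇓ ∷ []) (prec-⇓ (ifZero_then u else w) proj-⇓ (λ _ → proj-⇓) _)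

  ⊓ᴾ-⇓ : a ⟨ p ⟩ xs ⇓ u → b ⟨ p ⟩ xs ⇓ w → a ⊓ᴾ b ⟨ p ⟩ xs ⇓ u ⊓ w
  ⊓ᴾ-⇓ {u = u} {w = w} a⇓ b⇓ = ⇓-≡ (m∸[m∸n]≡m⊓n u w) (∸ᴾ-⇓ a⇓ (∸ᴾ-⇓ a⇓ b⇓))

  isZeroᴾ-⇓ : a ⟨ p ⟩ xs ⇓ u → isZeroᴾ a ⟨ p ⟩ xs ⇓ isZero u
  isZeroᴾ-⇓ a⇓ = ifZeroᴾ-⇓ a⇓ (constᴾ-⇓ 1) (constᴾ-⇓ 0)

  χ<ᴾ-⇓ : a ⟨ p ⟩ xs ⇓ u → b ⟨ p ⟩ xs ⇓ w → χ<ᴾ a b ⟨ p ⟩ xs ⇓ χ< u w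
  χ<ᴾ-⇓ a⇓ b⇓ = isZeroᴾ-⇓ (∸ᴾ-⇓ b⇓ a⇓)

  χ≢ᴾ-⇓ : a ⟨ p ⟩ xs ⇓ u → b ⟨ p ⟩ xs ⇓ w → χ≢ᴾ a b ⟨ p ⟩ xs ⇓ χ≢ u w
  χ≢ᴾ-⇓ a⇓ b⇓ = ifZeroᴾ-⇓ (∸ᴾ-⇓ a⇓ b⇓) (χ<ᴾ-⇓ a⇓ b⇓) (constᴾ-⇓ 0)

module _ {p : Baire} {N : ℕ} .{{_ : NonZero N}} where

  %ᴾ-⇓ : a ⟨ p ⟩ xs ⇓ u → a %ᴾ N ⟨ p ⟩ xs ⇓ u % N
  %ᴾ-⇓ a⇓ =
    comp-⇓ (a⇓ ∷ []) (prec-⇓ (_% N) (⇓-≡ (sym (m<n⇒m%n≡m (>-nonZero⁻¹ N))) zero-⇓) mod-step _)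
    where
    mod-step : ∀ x → _ ⟨ p ⟩ (x ∷ x % N ∷ []) ⇓ suc x % N
    mod-step x = ⇓-≡ (sym (proj₁ (suc-%-/ N x)))
      (ifZeroᴾ-⇓ (∸ᴾ-⇓ (constᴾ-⇓ N) (succᴾ-⇓ proj-⇓)) (constᴾ-⇓ 0) (succᴾ-⇓ proj-⇓))

  /ᴾ-⇓ : a ⟨ p ⟩ xs ⇓ u → a /ᴾ N ⟨ p ⟩ xs ⇓ u / N
  /ᴾ-⇓ a⇓ = comp-⇓ (a⇓ ∷ []) (prec-⇓ (_/ N) (⇓-≡ (sym (0/n≡0 N)) zero-⇓) div-step _)
    where
    div-step : ∀ x → _ ⟨ p ⟩ (x ∷ x / N ∷ []) ⇓ suc x / N
    div-step x = ⇓-≡ (sym (proj₂ (suc-%-/ N x)))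
      (ifZeroᴾ-⇓ (∸ᴾ-⇓ (constᴾ-⇓ N) (succᴾ-⇓ (%ᴾ-⇓ proj-⇓))) (succᴾ-⇓ proj-⇓) proj-⇓)

  digitᴾ-⇓ : a ⟨ p ⟩ xs ⇓ u → b ⟨ p ⟩ xs ⇓ w → digitᴾ N a b ⟨ p ⟩ xs ⇓ digit N u w
  digitᴾ-⇓ {u = u} a⇓ b⇓ =
    %ᴾ-⇓ (comp-⇓ (b⇓ ∷ a⇓ ∷ []) (prec-⇓ (dropDigits N u) proj-⇓ (λ _ → /ᴾ-⇓ proj-⇓) _))

prefixMin : ℕ → Baire → ℕ → ℕ
prefixMin k p zero    = k ⊓ p 0
prefixMin k p (suc x) = prefixMin k p x ⊓ p (suc x)

prefixMinF : ℕ → PR 1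
prefixMinF k = prec (constᴾ k ⊓ᴾ oracleᴾ (constᴾ 0)) (proj (# 1) ⊓ᴾ oracleᴾ (succᴾ (proj (# 0))))

prefixMinF-⇓ : ∀ {p} k x → prefixMinF k ⟨ p ⟩ [ x ] ⇓ prefixMin k p x
prefixMinF-⇓ {p} k = prec-⇓ (prefixMin k p) (⊓ᴾ-⇓ (constᴾ-⇓ k) (oracleᴾ-⇓ (constᴾ-⇓ 0)))
  (λ _ → ⊓ᴾ-⇓ proj-⇓ (oracleᴾ-⇓ (succᴾ-⇓ proj-⇓)))

module _ {k : ℕ} {p : Baire} where

  prefixMin-≤ : ∀ {t x} → t ≤ x → prefixMin k p x ≤ p t
  prefixMin-≤ {x = zero} z≤n = m⊓n≤n k (p 0)
  prefixMin-≤ {x = suc x} t≤1+x with m≤n⇒m<n∨m≡n t≤1+x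
  ... | inj₁ (s≤s t≤x) = ≤-trans (m⊓n≤m _ _) (prefixMin-≤ t≤x)
  ... | inj₂ refl      = m⊓n≤n _ _

  prefixMin-sel : ∀ x → prefixMin k p x ≡ k ⊎ ∃ λ t → prefixMin k p x ≡ p t
  prefixMin-sel zero with ⊓-sel k (p 0)
  ... | inj₁ ≡k  = inj₁ ≡k
  ... | inj₂ ≡p0 = inj₂ (0 , ≡p0)
  prefixMin-sel (suc x) with ⊓-sel (prefixMin k p x) (p (suc x)) | prefixMin-sel x
  ... | inj₂ ≡p[1+x] | _                 = inj₂ (suc x , ≡p[1+x])
  ... | inj₁ ≡prev   | inj₁ prev≡k       = inj₁ (trans ≡prev prev≡k)
  ... | inj₁ ≡prev   | inj₂ (t , prev≡pt) = inj₂ (t , trans ≡prev prev≡pt)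

accLimit : ∀ {k p} → Inst (ACC k) p → ℕ
accLimit     (inj₁ (ℓ , _)) = ℓ
accLimit {k} (inj₂ _)       = k

appears-below⇒≡accLimit : ∀ {k p ℓ} (I : Inst (ACC k) p) → ℓ < k → Appears ℓ p → ℓ ≡ accLimit I
appears-below⇒≡accLimit (inj₁ (_ , _ , _ , unique)) ℓ<k appears = unique _ ℓ<k appears
appears-below⇒≡accLimit (inj₂ constant) ℓ<k (i , pi≡ℓ) =
  contradiction (trans (sym pi≡ℓ) (constant i)) (<⇒≢ ℓ<k)

ACC-solution : ∀ {k p v} (I : Inst (ACC k) p) → v < k → v ≢ accLimit I → Sol (ACC k) p (λ _ → v)
ACC-solution I v<k v≢limit = v<k , λ ℓ (ℓ<k , appears , _) v≡ℓ →
  v≢limit (trans v≡ℓ (appears-below⇒≡accLimit I ℓ<k appears))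

prefixMin-stabilises : ∀ {k p} (I : Inst (ACC k) p) →
                       ∃ λ t₀ → ∀ x → t₀ ≤ x → prefixMin k p x ≡ accLimit I
prefixMin-stabilises {k} {p} (inj₂ constant) = 0 , λ x _ → stable x
  where
  stable : ∀ x → prefixMin k p x ≡ k
  stable x with prefixMin-sel x
  ... | inj₁ ≡k       = ≡k
  ... | inj₂ (t , ≡pt) = trans ≡pt (constant t)
prefixMin-stabilises {k} {p} (inj₁ (ℓ , ℓ<k , (t₀ , pt₀≡ℓ) , unique)) = t₀ , stable
  where
  stable : ∀ x → t₀ ≤ x → prefixMin k p x ≡ ℓ
  stable x t₀≤x with prefixMin-sel x | subst (prefixMin k p x ≤_) pt₀≡ℓ (prefixMin-≤ t₀≤x)
  ... | inj₁ ≡k        | ≤ℓ = contradiction (subst (_≤ ℓ) ≡k ≤ℓ) (<⇒≱ ℓ<k)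
  ... | inj₂ (t , ≡pt) | ≤ℓ =
    trans ≡pt (unique (p t) (≤-<-trans (subst (_≤ ℓ) ≡pt ≤ℓ) ℓ<k) (t , refl))

Lim-unique : ∀ {m q i v w} → Lim m q i v → Lim m q i w → v ≡ w
Lim-unique (s₀ , v-from) (s₁ , w-from) =
  trans (sym (v-from (s₀ ⊔ s₁) (m≤m⊔n s₀ s₁))) (w-from (s₀ ⊔ s₁) (m≤n⊔m s₀ s₁))

join-even : ∀ p q t → join p q (t + t) ≡ p t
join-even p q zero    = refl
join-even p q (suc t) =
  trans (cong (join p q) (cong suc (+-suc t t))) (join-even (λ i → p (suc i)) (λ i → q (suc i)) t)

evenOracleᴾ : ∀ {k} → PR k → PR k
evenOracleᴾ t = oracleᴾ (t +ᴾ t)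

evenOracleᴾ-⇓ : ∀ {q} → a ⟨ q ⟩ xs ⇓ u → evenOracleᴾ a ⟨ q ⟩ xs ⇓ q (u + u)
evenOracleᴾ-⇓ a⇓ = oracleᴾ-⇓ (+ᴾ-⇓ a⇓ a⇓)

module Reduction (k n : ℕ) .{{_ : NonZero n}} where

  m : ℕ
  m = n ^ (k + 1)

  private instance
    m-nonZero : NonZero m
    m-nonZero = m^n≢0 n (k + 1)

  φ : Baire → Baire
  φ p x = digit n (x % m) (prefixMin k p x)

  Φ : PR 1
  Φ = digitᴾ n (proj (# 0) %ᴾ m) (prefixMinF k)

  Φ-computes : ∀ p → Computes Φ p (φ p)
  Φ-computes p x = digitᴾ-⇓ (%ᴾ-⇓ proj-⇓) (prefixMinF-⇓ k x)

  φ-Lim : ∀ {p} (I : Inst (ACC k) p) → ∀ {i} → i < m → Lim m (φ p) i (digit n i (accLimit I))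
  φ-Lim {p} I {i} i<m = let t₀ , stable = prefixMin-stabilises I in
    t₀ , λ s t₀≤s → cong₂ (digit n) (position s) (stable (s * m + i) (≤-trans t₀≤s (s≤s*m+i s)))
    where
    position : ∀ s → (s * m + i) % m ≡ i
    position s = trans (cong (_% m) (+-comm (s * m) i)) (trans ([m+kn]%n≡m%n i s m) (m<n⇒m%n≡m i<m))
    s≤s*m+i : ∀ s → s ≤ s * m + i
    s≤s*m+i s = ≤-trans (m≤m*n s m) (m≤m+n (s * m) i)

  φ-instance : ∀ {p} → Inst (ACC k) p → Inst (PHP′ m n) (φ p)
  φ-instance I = (λ s i _ → m%n<n _ n) , λ i i<m → _ , φ-Lim I i<m

  solution-digits-agree : ∀ {p} y (I : Inst (ACC k) p) → Sol (PHP′ m n) (φ p) y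
                        → digit n (y 0) (accLimit I) ≡ digit n (y 1) (accLimit I)
  solution-digits-agree {p} y I (y0<m , y1<m , _ , _ , lim₀ , lim₁) =
    trans (Lim-unique {m} {φ p} {y 0} (φ-Lim I y0<m) lim₀)
          (Lim-unique {m} {φ p} {y 1} lim₁ (φ-Lim I y1<m))

  -- In q = join p y the pigeons y 0 and y 1 sit at q 1 and q 3, and p t sits at q (t + t).
  -- The search succeeds at r < k where the digits of the two pigeons differ, and at r = k + t
  -- where p t < k.
  ψ-test : Baire → ℕ → ℕ
  ψ-test q r = ifZero k ∸ r then χ< (q (r ∸ k + (r ∸ k))) k
                            else χ≢ (digit n (q 1) r) (digit n (q 3) r)

  ψ-out : Baire → ℕ → ℕ
  ψ-out q r = ifZero k ∸ r then isZero (q (r ∸ k + (r ∸ k))) else r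

  Ψ-test : PR 1
  Ψ-test = ifZeroᴾ constᴾ k ∸ᴾ r
    then χ<ᴾ (evenOracleᴾ (r ∸ᴾ constᴾ k)) (constᴾ k)
    else χ≢ᴾ (digitᴾ n (oracleᴾ (constᴾ 1)) r) (digitᴾ n (oracleᴾ (constᴾ 3)) r)
    where r = proj (# 0)

  Ψ-out : PR 1
  Ψ-out = ifZeroᴾ constᴾ k ∸ᴾ r then isZeroᴾ (evenOracleᴾ (r ∸ᴾ constᴾ k)) else r
    where r = proj (# 0)

  Ψ : PR 1
  Ψ = comp (comp Ψ-out [ mu Ψ-test ]) []

  Ψ-test-⇓ : ∀ q r → Ψ-test ⟨ q ⟩ [ r ] ⇓ ψ-test q r
  Ψ-test-⇓ q r = ifZeroᴾ-⇓ (∸ᴾ-⇓ (constᴾ-⇓ k) proj-⇓)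
    (χ<ᴾ-⇓ (evenOracleᴾ-⇓ (∸ᴾ-⇓ proj-⇓ (constᴾ-⇓ k))) (constᴾ-⇓ k))
    (χ≢ᴾ-⇓ (digitᴾ-⇓ (oracleᴾ-⇓ (constᴾ-⇓ 1)) proj-⇓) (digitᴾ-⇓ (oracleᴾ-⇓ (constᴾ-⇓ 3)) proj-⇓))

  Ψ-out-⇓ : ∀ q r → Ψ-out ⟨ q ⟩ [ r ] ⇓ ψ-out q r
  Ψ-out-⇓ q r = ifZeroᴾ-⇓ (∸ᴾ-⇓ (constᴾ-⇓ k) proj-⇓)
    (isZeroᴾ-⇓ (evenOracleᴾ-⇓ (∸ᴾ-⇓ proj-⇓ (constᴾ-⇓ k)))) proj-⇓

  Ψ-computes : ∀ q → (∃ λ j → ψ-test q j ≡ 0) →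
               ∃ λ r → ψ-test q r ≡ 0 × Computes Ψ q (λ _ → ψ-out q r)
  Ψ-computes q (j , ψ-test≡0) =
    let r , ψ-test-r≡0 , μ⇓ = mu-⇓ (ψ-test q) (Ψ-test-⇓ q) {j} ψ-test≡0
    in r , ψ-test-r≡0 , λ _ → comp-⇓ [] (comp-⇓ (μ⇓ ∷ []) (Ψ-out-⇓ q r))

  ψ-test-root : ∀ {p} y (I : Inst (ACC k) p) → Sol (PHP′ m n) (φ p) y →
                ∃ λ r → ψ-test (join p y) r ≡ 0
  ψ-test-root {p} y I sol@(y0<m , y1<m , y0≢y1 , _)
    with digits-separate n (k + 1) y0<m y1<m y0≢y1
  ... | d , d<k+1 , differ with m<1+n⇒m<n∨m≡n (subst (d <_) (+-comm k 1) d<k+1)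
  ...   | inj₁ d<k  = d , trans (ifZero-∸-> d<k) (≢⇒χ≢≡0 differ)
  ...   | inj₂ refl = root I (solution-digits-agree y I sol)
    where
    root : (I : Inst (ACC k) p) → digit n (y 0) (accLimit I) ≡ digit n (y 1) (accLimit I)
         → ∃ λ r → ψ-test (join p y) r ≡ 0
    root (inj₂ _) agree = contradiction agree differ
    root (inj₁ (ℓ , ℓ<k , (t , pt≡ℓ) , _)) _ = k + t , (begin
      ψ-test (join p y) (k + t)
        ≡⟨ ifZero-∸-≤ (m≤m+n k t) ⟩
      χ< (join p y (k + t ∸ k + (k + t ∸ k))) k
        ≡⟨ cong (λ t′ → χ< (join p y (t′ + t′)) k) (m+n∸m≡n k t) ⟩
      χ< (join p y (t + t)) k
        ≡⟨ cong (λ v → χ< v k) (trans (join-even p y t) pt≡ℓ) ⟩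
      χ< ℓ k
        ≡⟨ <⇒χ<≡0 ℓ<k ⟩
      0 ∎)
      where open ≡-Reasoning

  ψ-out-solves : ∀ {p} y r → 2 ≤ k → (I : Inst (ACC k) p) → Sol (PHP′ m n) (φ p) y
               → ψ-test (join p y) r ≡ 0 → Sol (ACC k) p (λ _ → ψ-out (join p y) r)
  ψ-out-solves {p} y r 2≤k I sol ψ-test≡0 with r <? k
  ... | yes r<k = ACC-solution I (subst (_< k) (sym out≡r) r<k) λ out≡limit →
    differ (subst (λ c → digit n (y 0) c ≡ digit n (y 1) c) (trans (sym out≡limit) out≡r)
                  (solution-digits-agree y I sol))
    where
    out≡r : ψ-out (join p y) r ≡ r
    out≡r = ifZero-∸-> r<k
    differ : digit n (y 0) r ≢ digit n (y 1) r
    differ = χ≢≡0⇒≢ (trans (sym (ifZero-∸-> r<k)) ψ-test≡0)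
  ... | no r≮k = ACC-solution I (subst (_< k) (sym out≡) (<-≤-trans (isZero-< (p t)) 2≤k))
    λ out≡limit → isZero-≢ (p t)
      (trans (sym out≡) (trans out≡limit (sym (appears-below⇒≡accLimit I pt<k (t , refl)))))
    where
    t : ℕ
    t = r ∸ k
    out≡ : ψ-out (join p y) r ≡ isZero (p t)
    out≡ = trans (ifZero-∸-≤ (≮⇒≥ r≮k)) (cong isZero (join-even p y t))
    pt<k : p t < k
    pt<k = χ<≡0⇒< (begin
      χ< (p t) k                   ≡⟨ cong (λ v → χ< v k) (join-even p y t) ⟨
      χ< (join p y (t + t)) k      ≡⟨ ifZero-∸-≤ (≮⇒≥ r≮k) ⟨
      ψ-test (join p y) r          ≡⟨ ψ-test≡0 ⟩
      0                            ∎)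
      where open ≡-Reasoning

proposition3p13 : ∀ k n → 2 ≤ k → 2 ≤ n → ACC k ≤W PHP′ (n ^ (k + 1)) n
proposition3p13 k n 2≤k 2≤n = Φ , Ψ , λ p I → φ p , Φ-computes p , φ-instance I , λ y sol →
  let r , ψ-test≡0 , Ψ-computes-out = Ψ-computes (join p y) (ψ-test-root y I sol)
  in (λ _ → ψ-out (join p y) r) , Ψ-computes-out , ψ-out-solves y r 2≤k I sol ψ-test≡0
  where open Reduction k n {{>-nonZero (<-≤-trans z<s 2≤n)}}
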